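{- Let $m,n$ be integers with $1\le m\le n$ and $2\le n\le 2m+1$. Then $\dim(VG^1_{m,n})=3$.
   Context: For a connected graph $G$ and an ordered set $R=\{r_1,\dots,r_l\}\subseteq V(G)$, the code of a vertex $s$ is $(d(s,r_1),\dots,d(s,r_l))$, where $d$ is the shortest-path distance. $R$ is a resolving set if distinct vertices have distinct codes; $\dim(G)$ (the metric dimension) is the minimum cardinality of a resolving set. For integers $1\le m\le n$, the Villarceau grid Type I $VG^1_{m,n}$ is the graph with vertex set $\{(2i,2j+1): i\in\{0,\dots,n\},\ j\in\{0,\dots,m-1\}\}\cup\{(2i+1,2j): i\in\{0,\dots,n-1\},\ j\in\{0,\dots,m\}\}$, in which $(i_1,j_1)$ and $(i_2,j_2)$ are adjacent if and only if $|i_1-i_2|=1$ and $|j_1-j_2|=1$. -}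

module Defs where

open import Data.Nat using (ℕ; zero; suc; _+_; _*_; _≤_; ∣_-_∣)
open import Data.Fin using (Fin; toℕ)
open import Data.Product using (_×_; _,_; ∃)
open import Data.List using (List; length)
open import Data.List.Relation.Unary.All using (All)
open import Data.List.Relation.Unary.Unique.Propositional using (Unique)
open import Relation.Binary.PropositionalEquality using (_≡_)

data Walk {V : Set} (Adj : V → V → Set) : V → V → ℕ → Set where
  nil  : ∀ {u} → Walk Adj u u 0
  cons : ∀ {u v w k} → Adj u v → Walk Adj v w k → Walk Adj u w (suc k)

IsDist : {V : Set} (Adj : V → V → Set) → V → V → ℕ → Set
IsDist Adj u v k = Walk Adj u v k × (∀ j → Walk Adj u v j → k ≤ j)

SameCode : {V : Set} (Adj : V → V → Set) → List V → V → V → Set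
SameCode Adj R s t = All (λ r → ∃ λ a → IsDist Adj s r a × IsDist Adj t r a) R

Resolving : {V : Set} (Adj : V → V → Set) → List V → Set
Resolving Adj R = ∀ s t → SameCode Adj R s t → s ≡ t

MetricDim : {V : Set} (Adj : V → V → Set) → ℕ → Set
MetricDim {V} Adj k =
  (∃ λ (R : List V) → Unique R × length R ≡ k × Resolving Adj R)
  × (∀ (R : List V) → Unique R → Resolving Adj R → k ≤ length R)

data VGVertex (m n : ℕ) : Set where
  ev : Fin (suc n) → Fin m → VGVertex m n
  od : Fin n → Fin (suc m) → VGVertex m n

coordX : ∀ {m n} → VGVertex m n → ℕ
coordX (ev i j) = 2 * toℕ i
coordX (od i j) = 2 * toℕ i + 1

coordY : ∀ {m n} → VGVertex m n → ℕ
coordY (ev i j) = 2 * toℕ j + 1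
coordY (od i j) = 2 * toℕ j

VGAdj : (m n : ℕ) → VGVertex m n → VGVertex m n → Set
VGAdj m n u v = (∣ coordX u - coordX v ∣ ≡ 1) × (∣ coordY u - coordY v ∣ ≡ 1)

{-# OPTIONS --safe #-}
module Submission where

-- In the rotated coordinates P = (x + y - 1)/2 and Q = (x - y + 2m - 1)/2 of a vertex (x, y), the
-- graph VG¹_{m,n} is the grid graph on the lattice points (a, b) of the tilted square
-- m ≤ a + b + 1 ≤ 2n + m, ∣ a - b ∣ ≤ m, and its distance is the ℓ¹ distance: from any point some
-- grid step towards any other point stays in the square.
--
-- With one exception, every vertex r is adjacent to a vertex w whose four grid
-- neighbours are all vertices. At most one of them is r, the other three are at distance d(w, r) + 1
-- from r, and as the distance to any second vertex changes by exactly one along an edge, two of these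
-- three are not separated by it either. The exception is m = 1 with r on the diagonal a = b; if both
-- landmarks lie there, the vertices (1, 0) and (0, 1), mirror images in the diagonal, are twins.
--
-- Writing n = h + 1, take the landmarks (0, m), (h, c) and (h, h + m) with c = h - m
-- (c = 0 when m = n); n ≤ 2m + 1 means c ≤ m. Both last landmarks have a = h, so the difference of
-- the distances to them is ∣ b - c ∣ + b up to a constant, which determines b when b ≥ c. For
-- b ≤ c the first and last distances determine a + b and a - b, and finally a is read off the first.

open import Defs
open import Data.Nat
open import Data.Nat.Properties
open import Data.Nat.Tactic.RingSolver using (solve; solve-∀)
open import Data.Fin using (toℕ; fromℕ<)
open import Data.Fin.Properties using (toℕ<n; toℕ-fromℕ<; toℕ-injective)
open import Data.Product using (Σ; ∃; ∃₂; _×_; _,_; proj₁; proj₂)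
open import Data.Sum using (_⊎_; inj₁; inj₂)
open import Data.Empty using (⊥-elim)
open import Function.Base using (_∘_)
open import Data.List using (List; []; _∷_; length)
open import Data.List.Relation.Unary.All as All using (All)
open import Data.List.Relation.Unary.Unique.Propositional using (Unique)
open import Relation.Binary.Definitions using (DecidableEquality; tri<; tri≈; tri>)
open import Relation.Binary.PropositionalEquality
open import Relation.Nullary using (¬_; yes; no)

data Half : ℕ → Set where
  even : ∀ h → Half (2 * h)
  odd  : ∀ h → Half (suc (2 * h))

half : ∀ t → Half t
half zero = even 0
half (suc t) with half t
... | even h = odd h
... | odd h  = subst Half (*-suc 2 h) (even (suc h))

2*m≢1+2*n : ∀ m n → 2 * m ≢ suc (2 * n)
2*m≢1+2*n zero    n       ()
2*m≢1+2*n (suc m) zero    eq with trans (sym (*-suc 2 m)) eq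
... | ()
2*m≢1+2*n (suc m) (suc n) eq =
  2*m≢1+2*n m n (suc-injective (suc-injective (trans (sym (*-suc 2 m)) (trans eq (cong suc (*-suc 2 n))))))

∣n-1+n∣≡1 : ∀ n → ∣ n - suc n ∣ ≡ 1
∣n-1+n∣≡1 zero    = refl
∣n-1+n∣≡1 (suc n) = ∣n-1+n∣≡1 n

∣1+n-n∣≡1 : ∀ n → ∣ suc n - n ∣ ≡ 1
∣1+n-n∣≡1 n = trans (∣-∣-comm (suc n) n) (∣n-1+n∣≡1 n)

∣m-n∣≡1⇒n≡1+m⊎m≡1+n : ∀ m n → ∣ m - n ∣ ≡ 1 → n ≡ suc m ⊎ m ≡ suc n
∣m-n∣≡1⇒n≡1+m⊎m≡1+n zero          (suc zero)    _  = inj₁ refl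
∣m-n∣≡1⇒n≡1+m⊎m≡1+n (suc zero)    zero          _  = inj₂ refl
∣m-n∣≡1⇒n≡1+m⊎m≡1+n (suc m)       (suc n)       eq with ∣m-n∣≡1⇒n≡1+m⊎m≡1+n m n eq
... | inj₁ n≡1+m = inj₁ (cong suc n≡1+m)
... | inj₂ m≡1+n = inj₂ (cong suc m≡1+n)
∣m-n∣≡1⇒n≡1+m⊎m≡1+n zero          zero          ()
∣m-n∣≡1⇒n≡1+m⊎m≡1+n zero          (suc (suc n)) ()
∣m-n∣≡1⇒n≡1+m⊎m≡1+n (suc (suc m)) zero          ()

n≤m⇒∣1+m-n∣≡1+∣m-n∣ : ∀ {m n} → n ≤ m → ∣ suc m - n ∣ ≡ suc ∣ m - n ∣
n≤m⇒∣1+m-n∣≡1+∣m-n∣ {m} z≤n       = cong suc (sym (∣-∣-identityʳ m))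
n≤m⇒∣1+m-n∣≡1+∣m-n∣     (s≤s n≤m) = n≤m⇒∣1+m-n∣≡1+∣m-n∣ n≤m

m<n⇒∣m-n∣≡1+∣1+m-n∣ : ∀ {m n} → m < n → ∣ m - n ∣ ≡ suc ∣ suc m - n ∣
m<n⇒∣m-n∣≡1+∣1+m-n∣ {zero}  {suc n} _         = refl
m<n⇒∣m-n∣≡1+∣1+m-n∣ {suc m} {suc n} (s≤s m<n) = m<n⇒∣m-n∣≡1+∣1+m-n∣ m<n

OneApart : ℕ → ℕ → Set
OneApart x y = y ≡ suc x ⊎ x ≡ suc y

OneApart-sym : ∀ {x y} → OneApart x y → OneApart y x
OneApart-sym (inj₁ y≡1+x) = inj₂ y≡1+x
OneApart-sym (inj₂ x≡1+y) = inj₁ x≡1+y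

OneApart-+ʳ : ∀ {x y} z → OneApart x y → OneApart (x + z) (y + z)
OneApart-+ʳ z (inj₁ y≡1+x) = inj₁ (cong (_+ z) y≡1+x)
OneApart-+ʳ z (inj₂ x≡1+y) = inj₂ (cong (_+ z) x≡1+y)

OneApart-+ˡ : ∀ {x y} z → OneApart x y → OneApart (z + x) (z + y)
OneApart-+ˡ {x} {y} z (inj₁ y≡1+x) = inj₁ (trans (cong (z +_) y≡1+x) (+-suc z x))
OneApart-+ˡ {x} {y} z (inj₂ x≡1+y) = inj₂ (trans (cong (z +_) x≡1+y) (+-suc z y))

∣m-n∣-OneApart-∣1+m-n∣ : ∀ m n → OneApart ∣ m - n ∣ ∣ suc m - n ∣
∣m-n∣-OneApart-∣1+m-n∣ m n with ≤-<-connex n m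
... | inj₁ n≤m = inj₁ (n≤m⇒∣1+m-n∣≡1+∣m-n∣ n≤m)
... | inj₂ m<n = inj₂ (m<n⇒∣m-n∣≡1+∣1+m-n∣ m<n)

module _ {V : Set} (Adj : V → V → Set) (d : V → V → ℕ) where

  ChangesByOne : Set
  ChangesByOne = ∀ u w → Adj u w → ∀ r → OneApart (d u r) (d w r)

  d≤walk-length : (∀ v → d v v ≡ 0) → ChangesByOne → ∀ {u v k} → Walk Adj u v k → d u v ≤ k
  d≤walk-length d-refl _     {u} nil = ≤-reflexive (d-refl u)
  d≤walk-length d-refl d±1 {u} {v} (cons {v = w} u~w w⇝v) with d±1 u w u~w v
  ... | inj₁ dw≡1+du = m<n⇒m≤1+n (subst (_≤ _) dw≡1+du (d≤walk-length d-refl d±1 w⇝v))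
  ... | inj₂ du≡1+dw = subst (_≤ _) (sym du≡1+dw) (s≤s (d≤walk-length d-refl d±1 w⇝v))

empty-walk⇒≡ : ∀ {V : Set} {Adj : V → V → Set} {u v} → Walk Adj u v 0 → u ≡ v
empty-walk⇒≡ nil = refl

module MetricDimension {V : Set} (Adj : V → V → Set) (d : V → V → ℕ)
                       (d-isDist : ∀ u v → IsDist Adj u v (d u v)) where

  -- Imported here rather than at the top: these overloaded constructors would make the variable
  -- lists passed to the ring solver's solve ambiguous.
  open import Data.List.Relation.Unary.All using ([]; _∷_)
  open import Data.List.Relation.Unary.AllPairs using ([]; _∷_)

  isDist⇒≡d : ∀ {u v k} → IsDist Adj u v k → k ≡ d u v
  isDist⇒≡d {u} {v} (u⇝v , minimal) =
    ≤-antisym (minimal _ (proj₁ (d-isDist u v))) (proj₂ (d-isDist u v) _ u⇝v)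

  d-refl : ∀ u → d u u ≡ 0
  d-refl u = sym (isDist⇒≡d (nil , λ _ _ → z≤n))

  d≡0⇒≡ : ∀ {u v} → d u v ≡ 0 → u ≡ v
  d≡0⇒≡ {u} {v} d≡0 = empty-walk⇒≡ (subst (Walk Adj u v) d≡0 (proj₁ (d-isDist u v)))

  sameCode⇒≡d : ∀ {R s t} → SameCode Adj R s t → All (λ r → d s r ≡ d t r) R
  sameCode⇒≡d = All.map λ (_ , s-r , t-r) → trans (sym (isDist⇒≡d s-r)) (isDist⇒≡d t-r)

  record Twins (r₁ r₂ : V) : Set where
    constructor twins
    field
      {s t} : V
      s≢t   : s ≢ t
      same₁ : d s r₁ ≡ d t r₁
      same₂ : d s r₂ ≡ d t r₂

  Twins-sym : ∀ {r₁ r₂} → Twins r₁ r₂ → Twins r₂ r₁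
  Twins-sym (twins s≢t same₁ same₂) = twins s≢t same₂ same₁

  ¬resolving : ∀ {s t R} → s ≢ t → All (λ r → d s r ≡ d t r) R → ¬ Resolving Adj R
  ¬resolving {s} {t} s≢t same resolving = s≢t (resolving s t (All.map sameCode same))
    where
      sameCode : ∀ {r} → d s r ≡ d t r → ∃ λ k → IsDist Adj s r k × IsDist Adj t r k
      sameCode {r} e = d s r , d-isDist s r , subst (IsDist Adj t r) (sym e) (d-isDist t r)

  3≤length-resolving : V → (∀ r₁ r₂ → Twins r₁ r₂) → ∀ R → Resolving Adj R → 3 ≤ length R
  3≤length-resolving v all-twins [] res with all-twins v v
  ... | twins s≢t _ _ = ⊥-elim (¬resolving s≢t [] res)
  3≤length-resolving v all-twins (r ∷ []) res with all-twins r r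
  ... | twins s≢t e _ = ⊥-elim (¬resolving s≢t (e ∷ []) res)
  3≤length-resolving v all-twins (r₁ ∷ r₂ ∷ []) res with all-twins r₁ r₂
  ... | twins s≢t e₁ e₂ = ⊥-elim (¬resolving s≢t (e₁ ∷ e₂ ∷ []) res)
  3≤length-resolving _ _ (_ ∷ _ ∷ _ ∷ _) _ = s≤s (s≤s (s≤s z≤n))

  module _ (d±1 : ChangesByOne Adj d) (_≟ᵥ_ : DecidableEquality V) where

    twins-of-equidistant-neighbours :
      ∀ {w x y z r₁} r₂ → Adj w x → Adj w y → Adj w z → x ≢ y → x ≢ z → y ≢ z →
      d x r₁ ≡ d y r₁ → d x r₁ ≡ d z r₁ → Twins r₁ r₂
    twins-of-equidistant-neighbours r₂ w~x w~y w~z x≢y x≢z y≢z xy₁ xz₁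
      with d±1 _ _ w~x r₂ | d±1 _ _ w~y r₂ | d±1 _ _ w~z r₂
    ... | inj₁ x↑ | inj₁ y↑ | _       = twins x≢y xy₁ (trans x↑ (sym y↑))
    ... | inj₂ x↓ | inj₂ y↓ | _       = twins x≢y xy₁ (suc-injective (trans (sym x↓) y↓))
    ... | inj₁ x↑ | inj₂ _  | inj₁ z↑ = twins x≢z xz₁ (trans x↑ (sym z↑))
    ... | inj₂ x↓ | inj₁ _  | inj₂ z↓ = twins x≢z xz₁ (suc-injective (trans (sym x↓) z↓))
    ... | inj₁ _  | inj₂ y↓ | inj₂ z↓ = twins y≢z (trans (sym xy₁) xz₁) (suc-injective (trans (sym y↓) z↓))
    ... | inj₂ _  | inj₁ y↑ | inj₁ z↑ = twins y≢z (trans (sym xy₁) xz₁) (trans y↑ (sym z↑))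

    adj⇒d≡1 : ∀ {u w} → Adj u w → d w u ≡ 1
    adj⇒d≡1 {u} {w} u~w with d±1 u w u~w u
    ... | inj₁ dw≡1+du = trans dw≡1+du (cong suc (d-refl u))
    ... | inj₂ du≡1+dw with trans (sym (d-refl u)) du≡1+dw
    ...   | ()

    moves-away : ∀ {w x r} → Adj w x → d w r ≤ 1 → x ≢ r → d x r ≡ suc (d w r)
    moves-away {w} {x} {r} w~x dw≤1 x≢r with d±1 w x w~x r
    ... | inj₁ x↑ = x↑
    ... | inj₂ x↓ = ⊥-elim (x≢r (d≡0⇒≡ (n≤0⇒n≡0 (≤-pred (subst (_≤ 1) x↓ dw≤1)))))

    twins-of-three-neighbours :
      ∀ {w x y z r₁} r₂ → d w r₁ ≤ 1 → Adj w x → Adj w y → Adj w z → x ≢ y → x ≢ z → y ≢ z →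
      x ≢ r₁ → y ≢ r₁ → z ≢ r₁ → Twins r₁ r₂
    twins-of-three-neighbours r₂ dw≤1 w~x w~y w~z x≢y x≢z y≢z x≢r y≢r z≢r =
      twins-of-equidistant-neighbours r₂ w~x w~y w~z x≢y x≢z y≢z
        (trans (moves-away w~x dw≤1 x≢r) (sym (moves-away w~y dw≤1 y≢r)))
        (trans (moves-away w~x dw≤1 x≢r) (sym (moves-away w~z dw≤1 z≢r)))

    twins-near-four-neighbours :
      ∀ w {r₁} r₂ {x₁ x₂ x₃ x₄} → d w r₁ ≤ 1 → All (Adj w) (x₁ ∷ x₂ ∷ x₃ ∷ x₄ ∷ []) →
      Unique (x₁ ∷ x₂ ∷ x₃ ∷ x₄ ∷ []) → Twins r₁ r₂
    twins-near-four-neighbours w {r₁} r₂ {x₁} {x₂} {x₃} dw≤1 (w~₁ ∷ w~₂ ∷ w~₃ ∷ w~₄ ∷ [])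
      ((≢₁₂ ∷ ≢₁₃ ∷ ≢₁₄ ∷ []) ∷ (≢₂₃ ∷ ≢₂₄ ∷ []) ∷ (≢₃₄ ∷ []) ∷ [] ∷ [])
      with x₁ ≟ᵥ r₁ | x₂ ≟ᵥ r₁ | x₃ ≟ᵥ r₁
    ... | yes refl | _        | _        =
      twins-of-three-neighbours r₂ dw≤1 w~₂ w~₃ w~₄ ≢₂₃ ≢₂₄ ≢₃₄ (≢-sym ≢₁₂) (≢-sym ≢₁₃) (≢-sym ≢₁₄)
    ... | no ≢₁    | yes refl | _        =
      twins-of-three-neighbours r₂ dw≤1 w~₁ w~₃ w~₄ ≢₁₃ ≢₁₄ ≢₃₄ ≢₁ (≢-sym ≢₂₃) (≢-sym ≢₂₄)
    ... | no ≢₁    | no ≢₂    | yes refl =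
      twins-of-three-neighbours r₂ dw≤1 w~₁ w~₂ w~₄ ≢₁₂ ≢₁₄ ≢₂₄ ≢₁ ≢₂ (≢-sym ≢₃₄)
    ... | no ≢₁    | no ≢₂    | no ≢₃    =
      twins-of-three-neighbours r₂ dw≤1 w~₁ w~₂ w~₃ ≢₁₂ ≢₁₃ ≢₂₃ ≢₁ ≢₂ ≢₃

data GridAdj : ℕ → ℕ → ℕ → ℕ → Set where
  inc-a : ∀ {a b} → GridAdj a b (suc a) b
  dec-a : ∀ {a b} → GridAdj (suc a) b a b
  inc-b : ∀ {a b} → GridAdj a b a (suc b)
  dec-b : ∀ {a b} → GridAdj a (suc b) a b

module Coordinates (m n : ℕ) where

  V : Set
  V = VGVertex m n

  Adj : V → V → Set
  Adj = VGAdj m n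

  P Q : V → ℕ
  P (ev i j) = toℕ i + toℕ j
  P (od i j) = toℕ i + toℕ j
  Q (ev i j) = toℕ i + (m ∸ suc (toℕ j))
  Q (od i j) = toℕ i + (m ∸ toℕ j)

  -- X = a + b + 1 - m and Y = a - b + m, stated without subtraction.
  record Rotated (X Y a b : ℕ) : Set where
    constructor rotation
    field
      X+m≡1+a+b : X + m ≡ suc (a + b)
      Y+b≡a+m   : Y + b ≡ a + m

  rotated-ev : ∀ I {J K} → suc J + K ≡ m → Rotated (2 * I) (2 * J + 1) (I + J) (I + K)
  rotated-ev I {J} {K} eq = rotation
    (begin
      2 * I + m               ≡⟨ cong (2 * I +_) (sym eq) ⟩
      2 * I + (suc J + K)     ≡⟨ solve (I ∷ J ∷ K ∷ []) ⟩
      suc (I + J + (I + K))   ∎)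
    (begin
      2 * J + 1 + (I + K)     ≡⟨ solve (I ∷ J ∷ K ∷ []) ⟩
      I + J + (suc J + K)     ≡⟨ cong (I + J +_) eq ⟩
      I + J + m               ∎)
    where open ≡-Reasoning

  rotated-od : ∀ I {J K} → J + K ≡ m → Rotated (2 * I + 1) (2 * J) (I + J) (I + K)
  rotated-od I {J} {K} eq = rotation
    (begin
      2 * I + 1 + m           ≡⟨ cong (2 * I + 1 +_) (sym eq) ⟩
      2 * I + 1 + (J + K)     ≡⟨ solve (I ∷ J ∷ K ∷ []) ⟩
      suc (I + J + (I + K))   ∎)
    (begin
      2 * J + (I + K)         ≡⟨ solve (I ∷ J ∷ K ∷ []) ⟩
      I + J + (J + K)         ≡⟨ cong (I + J +_) eq ⟩
      I + J + m               ∎)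
    where open ≡-Reasoning

  rotated : ∀ (v : V) → Rotated (coordX v) (coordY v) (P v) (Q v)
  rotated (ev i j) = rotated-ev (toℕ i) (m+[n∸m]≡n (toℕ<n j))
  rotated (od i j) = rotated-od (toℕ i) (m+[n∸m]≡n (≤-pred (toℕ<n j)))

  Rotated⇒X+Y≡1+2a : ∀ {X Y a b} → Rotated X Y a b → X + Y ≡ suc (2 * a)
  Rotated⇒X+Y≡1+2a {X} {Y} {a} {b} (rotation x y) = +-cancelʳ-≡ (m + b) _ _ (begin
    X + Y + (m + b)          ≡⟨ solve (X ∷ Y ∷ m ∷ b ∷ []) ⟩
    (X + m) + (Y + b)        ≡⟨ cong₂ _+_ x y ⟩
    suc (a + b) + (a + m)    ≡⟨ solve (a ∷ b ∷ m ∷ []) ⟩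
    suc (2 * a) + (m + b)    ∎)
    where open ≡-Reasoning

  Rotated-unique : ∀ {X Y a b a′ b′} → Rotated X Y a b → Rotated X Y a′ b′ → a ≡ a′ × b ≡ b′
  Rotated-unique {a = a} {a′ = a′} r@(rotation x _) r′@(rotation x′ _) = a≡a′ , b≡b′
    where
      a≡a′ = *-cancelˡ-≡ a a′ 2 (suc-injective (trans (sym (Rotated⇒X+Y≡1+2a r)) (Rotated⇒X+Y≡1+2a r′)))
      b≡b′ = +-cancelˡ-≡ a′ _ _ (trans (cong (_+ _) (sym a≡a′)) (suc-injective (trans (sym x) x′)))

  Rotated-injective : ∀ {X Y X′ Y′ a b} → Rotated X Y a b → Rotated X′ Y′ a b → X ≡ X′ × Y ≡ Y′
  Rotated-injective (rotation x y) (rotation x′ y′) =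
    +-cancelʳ-≡ m _ _ (trans x (sym x′)) , +-cancelʳ-≡ _ _ _ (trans y (sym y′))

  Rotated-suc-a : ∀ {X Y a b} → Rotated X Y a b → Rotated (suc X) (suc Y) (suc a) b
  Rotated-suc-a (rotation x y) = rotation (cong suc x) (cong suc y)

  Rotated-suc-b : ∀ {X Y a b} → Rotated X (suc Y) a b → Rotated (suc X) Y a (suc b)
  Rotated-suc-b {X} {Y} {a} {b} (rotation x y) =
    rotation (trans (cong suc x) (cong suc (sym (+-suc a b)))) (trans (+-suc Y b) y)

  Rotated-inc-b : ∀ {X Y X′ Y′ a b} → Rotated X Y a b → Rotated X′ Y′ a (suc b) → X′ ≡ suc X × Y ≡ suc Y′
  Rotated-inc-b {Y′ = Y′} {a} {b} (rotation x y) (rotation x′ y′) =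
    +-cancelʳ-≡ m _ _ (trans x′ (trans (cong suc (+-suc a b)) (cong suc (sym x)))) ,
    +-cancelʳ-≡ b _ _ (trans y (trans (sym y′) (+-suc Y′ b)))

  gridAdj⇒unit-steps : ∀ {X Y X′ Y′ a b a′ b′} → Rotated X Y a b → Rotated X′ Y′ a′ b′ →
                       GridAdj a b a′ b′ → ∣ X - X′ ∣ ≡ 1 × ∣ Y - Y′ ∣ ≡ 1
  gridAdj⇒unit-steps {X} {Y} r r′ inc-a with Rotated-injective (Rotated-suc-a r) r′
  ... | refl , refl = ∣n-1+n∣≡1 X , ∣n-1+n∣≡1 Y
  gridAdj⇒unit-steps {X′ = X′} {Y′} r r′ dec-a with Rotated-injective (Rotated-suc-a r′) r
  ... | refl , refl = ∣1+n-n∣≡1 X′ , ∣1+n-n∣≡1 Y′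
  gridAdj⇒unit-steps {X} {Y′ = Y′} r r′ inc-b with Rotated-inc-b r r′
  ... | refl , refl = ∣n-1+n∣≡1 X , ∣1+n-n∣≡1 Y′
  gridAdj⇒unit-steps {Y = Y} {X′} r r′ dec-b with Rotated-inc-b r′ r
  ... | refl , refl = ∣1+n-n∣≡1 X′ , ∣n-1+n∣≡1 Y

  unit-steps⇒gridAdj : ∀ {X Y X′ Y′ a b a′ b′} → Rotated X Y a b → Rotated X′ Y′ a′ b′ →
                       ∣ X - X′ ∣ ≡ 1 → ∣ Y - Y′ ∣ ≡ 1 → GridAdj a b a′ b′
  unit-steps⇒gridAdj {X} {Y} {X′} {Y′} r r′ ∣ΔX∣≡1 ∣ΔY∣≡1
    with ∣m-n∣≡1⇒n≡1+m⊎m≡1+n X X′ ∣ΔX∣≡1 | ∣m-n∣≡1⇒n≡1+m⊎m≡1+n Y Y′ ∣ΔY∣≡1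
  ... | inj₁ refl | inj₁ refl with Rotated-unique (Rotated-suc-a r) r′
  ...   | refl , refl = inc-a
  unit-steps⇒gridAdj r r′ _ _ | inj₁ refl | inj₂ refl with Rotated-unique (Rotated-suc-b r) r′
  ...   | refl , refl = inc-b
  unit-steps⇒gridAdj r r′ _ _ | inj₂ refl | inj₂ refl with Rotated-unique (Rotated-suc-a r′) r
  ...   | refl , refl = dec-a
  unit-steps⇒gridAdj r r′ _ _ | inj₂ refl | inj₁ refl with Rotated-unique (Rotated-suc-b r′) r
  ...   | refl , refl = dec-b

  adj⇒gridAdj : ∀ {u v : V} → Adj u v → GridAdj (P u) (Q u) (P v) (Q v)
  adj⇒gridAdj {u} {v} (∣ΔX∣≡1 , ∣ΔY∣≡1) = unit-steps⇒gridAdj (rotated u) (rotated v) ∣ΔX∣≡1 ∣ΔY∣≡1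

  gridAdj⇒adj : ∀ {u v : V} → GridAdj (P u) (Q u) (P v) (Q v) → Adj u v
  gridAdj⇒adj {u} {v} = gridAdj⇒unit-steps (rotated u) (rotated v)

  vertex-at : ∀ {X Y h} → X ≤ 2 * n → Y ≤ 2 * m → X + Y ≡ suc (2 * h) →
              Σ V λ v → coordX v ≡ X × coordY v ≡ Y
  vertex-at {X} {Y} {h} X≤2n Y≤2m X+Y≡1+2h with half X | half Y
  ... | even i | odd j = ev (fromℕ< i<1+n) (fromℕ< j<m) ,
                         cong (2 *_) (toℕ-fromℕ< i<1+n) ,
                         trans (cong (λ k → 2 * k + 1) (toℕ-fromℕ< j<m)) (+-comm (2 * j) 1)
    where
      i<1+n : i < suc n
      i<1+n = s≤s (*-cancelˡ-≤ {i} {n} 2 X≤2n)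
      j<m : j < m
      j<m = *-cancelˡ-< 2 j m Y≤2m
  ... | odd i | even j = od (fromℕ< i<n) (fromℕ< j<1+m) ,
                         trans (cong (λ k → 2 * k + 1) (toℕ-fromℕ< i<n)) (+-comm (2 * i) 1) ,
                         cong (2 *_) (toℕ-fromℕ< j<1+m)
    where
      i<n : i < n
      i<n = *-cancelˡ-< 2 i n X≤2n
      j<1+m : j < suc m
      j<1+m = s≤s (*-cancelˡ-≤ {j} {m} 2 Y≤2m)
  ... | even i | even j = ⊥-elim (2*m≢1+2*n (i + j) h (trans (*-distribˡ-+ 2 i j) X+Y≡1+2h))
  ... | odd i  | odd j  =
    ⊥-elim (2*m≢1+2*n h (i + j) (suc-injective (trans (sym X+Y≡1+2h) (begin
      suc (2 * i) + suc (2 * j)  ≡⟨ solve (i ∷ j ∷ []) ⟩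
      suc (suc (2 * (i + j)))    ∎))))
    where open ≡-Reasoning

  coords-injective : ∀ {u v : V} → coordX u ≡ coordX v → coordY u ≡ coordY v → u ≡ v
  coords-injective {ev i j} {ev i′ j′} x y =
    cong₂ ev (toℕ-injective (*-cancelˡ-≡ (toℕ i) (toℕ i′) 2 x))
             (toℕ-injective (*-cancelˡ-≡ (toℕ j) (toℕ j′) 2 (+-cancelʳ-≡ 1 _ _ y)))
  coords-injective {od i j} {od i′ j′} x y =
    cong₂ od (toℕ-injective (*-cancelˡ-≡ (toℕ i) (toℕ i′) 2 (+-cancelʳ-≡ 1 _ _ x)))
             (toℕ-injective (*-cancelˡ-≡ (toℕ j) (toℕ j′) 2 y))
  coords-injective {ev i j} {od i′ j′} x _ =
    ⊥-elim (2*m≢1+2*n (toℕ i) (toℕ i′) (trans x (+-comm (2 * toℕ i′) 1)))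
  coords-injective {od i j} {ev i′ j′} x _ =
    ⊥-elim (2*m≢1+2*n (toℕ i′) (toℕ i) (trans (sym x) (+-comm (2 * toℕ i) 1)))

  PQ-injective : ∀ {u v} → P u ≡ P v → Q u ≡ Q v → u ≡ v
  PQ-injective {u} {v} p q
    with Rotated-injective (rotated u) (subst₂ (Rotated (coordX v) (coordY v)) (sym p) (sym q) (rotated v))
  ... | x , y = coords-injective {u} {v} x y

  _≟ᵥ_ : DecidableEquality V
  u ≟ᵥ v with P u ≟ P v | Q u ≟ Q v
  ... | yes p | yes q = yes (PQ-injective {u} {v} p q)
  ... | no ¬p | _     = no (¬p ∘ cong P)
  ... | _     | no ¬q = no (¬q ∘ cong Q)

  record InRegion (a b : ℕ) : Set where
    constructor region
    field
      a≤b+m      : a ≤ b + m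
      b≤a+m      : b ≤ a + m
      m≤1+a+b    : m ≤ suc (a + b)
      1+a+b≤2n+m : suc (a + b) ≤ 2 * n + m
  open InRegion public

  Rotated⇒InRegion : ∀ {X Y a b} → Rotated X Y a b → X ≤ 2 * n → Y ≤ 2 * m → InRegion a b
  Rotated⇒InRegion {X} {Y} {a} {b} (rotation x y) X≤2n Y≤2m = region
    (+-cancelʳ-≤ m a (b + m) (begin
      a + m      ≡⟨ sym y ⟩
      Y + b      ≤⟨ +-monoˡ-≤ b Y≤2m ⟩
      2 * m + b  ≡⟨ solve (m ∷ b ∷ []) ⟩
      b + m + m  ∎))
    (subst (b ≤_) y (m≤n+m b Y))
    (subst (m ≤_) x (m≤n+m m X))
    (subst (_≤ 2 * n + m) x (+-monoˡ-≤ m X≤2n))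
    where open ≤-Reasoning

  InRegion⇒Rotated : ∀ {a b} → InRegion a b → ∃₂ λ X Y → Rotated X Y a b × X ≤ 2 * n × Y ≤ 2 * m
  InRegion⇒Rotated {a} {b} ω = X , Y , rotation x y ,
    +-cancelʳ-≤ m X (2 * n) (subst (_≤ 2 * n + m) (sym x) (1+a+b≤2n+m ω)) ,
    +-cancelʳ-≤ b Y (2 * m) (begin
      Y + b      ≡⟨ y ⟩
      a + m      ≤⟨ +-monoˡ-≤ m (a≤b+m ω) ⟩
      b + m + m  ≡⟨ solve (b ∷ m ∷ []) ⟩
      2 * m + b  ∎)
    where
      open ≤-Reasoning
      X = suc (a + b) ∸ m
      Y = a + m ∸ b
      x : X + m ≡ suc (a + b)
      x = m∸n+n≡m (m≤1+a+b ω)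
      y : Y + b ≡ a + m
      y = m∸n+n≡m (b≤a+m ω)

  coordX≤2n : ∀ (v : V) → coordX v ≤ 2 * n
  coordX≤2n (ev i _) = *-monoʳ-≤ 2 (≤-pred (toℕ<n i))
  coordX≤2n (od i _) = subst (_≤ 2 * n) (+-comm 1 (2 * toℕ i)) (*-monoʳ-< 2 (toℕ<n i))

  coordY≤2m : ∀ (v : V) → coordY v ≤ 2 * m
  coordY≤2m (ev _ j) = subst (_≤ 2 * m) (+-comm 1 (2 * toℕ j)) (*-monoʳ-< 2 (toℕ<n j))
  coordY≤2m (od _ j) = *-monoʳ-≤ 2 (≤-pred (toℕ<n j))

  inRegion : ∀ v → InRegion (P v) (Q v)
  inRegion v = Rotated⇒InRegion (rotated v) (coordX≤2n v) (coordY≤2m v)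

  record VertexAt (a b : ℕ) : Set where
    constructor vertexAt
    field
      vertex : V
      P≡     : P vertex ≡ a
      Q≡     : Q vertex ≡ b
  open VertexAt public using (vertex)

  vertex-in : ∀ {a b} → InRegion a b → VertexAt a b
  vertex-in {a} ω with InRegion⇒Rotated ω
  ... | _ , _ , r , X≤2n , Y≤2m with vertex-at {h = a} X≤2n Y≤2m (Rotated⇒X+Y≡1+2a r)
  ...   | v , refl , refl with Rotated-unique (rotated v) r
  ...     | P≡ , Q≡ = vertexAt v P≡ Q≡

  distinct-positions : ∀ {a b a′ b′} (x : VertexAt a b) (y : VertexAt a′ b′) → a ≢ a′ ⊎ b ≢ b′ →
                       vertex x ≢ vertex y
  distinct-positions (vertexAt _ refl _) (vertexAt _ refl _) (inj₁ a≢a′) = a≢a′ ∘ cong P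
  distinct-positions (vertexAt _ _ refl) (vertexAt _ _ refl) (inj₂ b≢b′) = b≢b′ ∘ cong Q

manhattan : ℕ → ℕ → ℕ → ℕ → ℕ
manhattan a b a′ b′ = ∣ a - a′ ∣ + ∣ b - b′ ∣

gridAdj⇒OneApart : ∀ {a b a′ b′} → GridAdj a b a′ b′ → ∀ c e →
                   OneApart (manhattan a b c e) (manhattan a′ b′ c e)
gridAdj⇒OneApart {a} {b} inc-a c e = OneApart-+ʳ ∣ b - e ∣ (∣m-n∣-OneApart-∣1+m-n∣ a c)
gridAdj⇒OneApart {b = b} {a′} dec-a c e = OneApart-sym (OneApart-+ʳ ∣ b - e ∣ (∣m-n∣-OneApart-∣1+m-n∣ a′ c))
gridAdj⇒OneApart {a} {b} inc-b c e = OneApart-+ˡ ∣ a - c ∣ (∣m-n∣-OneApart-∣1+m-n∣ b e)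
gridAdj⇒OneApart {a} {b′ = b′} dec-b c e = OneApart-sym (OneApart-+ˡ ∣ a - c ∣ (∣m-n∣-OneApart-∣1+m-n∣ b′ e))

closer-inc-a : ∀ {a b a′ b′ k} → a < a′ → manhattan a b a′ b′ ≡ suc k → manhattan (suc a) b a′ b′ ≡ k
closer-inc-a a<a′ e = suc-injective (trans (sym (cong (_+ _) (m<n⇒∣m-n∣≡1+∣1+m-n∣ a<a′))) e)

closer-dec-a : ∀ {a b a′ b′ k} → a′ ≤ a → manhattan (suc a) b a′ b′ ≡ suc k → manhattan a b a′ b′ ≡ k
closer-dec-a a′≤a e = suc-injective (trans (sym (cong (_+ _) (n≤m⇒∣1+m-n∣≡1+∣m-n∣ a′≤a))) e)

closer-inc-b : ∀ {a b a′ b′ k} → b < b′ → manhattan a b a′ b′ ≡ suc k → manhattan a (suc b) a′ b′ ≡ k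
closer-inc-b {a} {a′ = a′} b<b′ e =
  suc-injective (trans (sym (trans (cong (∣ a - a′ ∣ +_) (m<n⇒∣m-n∣≡1+∣1+m-n∣ b<b′)) (+-suc _ _))) e)

closer-dec-b : ∀ {a b a′ b′ k} → b′ ≤ b → manhattan a (suc b) a′ b′ ≡ suc k → manhattan a b a′ b′ ≡ k
closer-dec-b {a} {a′ = a′} b′≤b e =
  suc-injective (trans (sym (trans (cong (∣ a - a′ ∣ +_) (n≤m⇒∣1+m-n∣≡1+∣m-n∣ b′≤b)) (+-suc _ _))) e)

module Distance (m n : ℕ) (1≤m : 1 ≤ m) (1≤n : 1 ≤ n) where

  open Coordinates m n

  StepToward : ℕ → ℕ → ℕ → ℕ → ℕ → Set
  StepToward a b a′ b′ k = ∃₂ λ a₁ b₁ → InRegion a₁ b₁ × GridAdj a b a₁ b₁ × manhattan a₁ b₁ a′ b′ ≡ k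

  1+x≤x+m : ∀ x → suc x ≤ x + m
  1+x≤x+m x = subst (_≤ x + m) (+-comm x 1) (+-monoʳ-≤ x 1≤m)

  2+m≤2n+m : 2 + m ≤ 2 * n + m
  2+m≤2n+m = +-monoˡ-≤ m (*-monoʳ-≤ 2 1≤n)

  inRegion-inc-a : ∀ {a b} → InRegion a b → suc a ≤ b + m → suc (suc (a + b)) ≤ 2 * n + m → InRegion (suc a) b
  inRegion-inc-a ω a<b+m top = region a<b+m (m≤n⇒m≤1+n (b≤a+m ω)) (m≤n⇒m≤1+n (m≤1+a+b ω)) top

  inRegion-dec-a : ∀ {a b} → InRegion (suc a) b → suc b ≤ suc a + m → m ≤ suc a + b → InRegion a b
  inRegion-dec-a {a} ω b<a+m bottom =
    region (≤-trans (n≤1+n a) (a≤b+m ω)) (≤-pred b<a+m) bottom (≤-trans (n≤1+n _) (1+a+b≤2n+m ω))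

  inRegion-inc-b : ∀ {a b} → InRegion a b → suc b ≤ a + m → suc (suc (a + b)) ≤ 2 * n + m → InRegion a (suc b)
  inRegion-inc-b {a} {b} ω b<a+m top =
    region (m≤n⇒m≤1+n (a≤b+m ω)) b<a+m (≤-trans (m≤1+a+b ω) (s≤s (+-monoʳ-≤ a (n≤1+n b))))
           (subst (_≤ 2 * n + m) (sym (cong suc (+-suc a b))) top)

  inRegion-dec-b : ∀ {a b} → InRegion a (suc b) → suc a ≤ suc b + m → m ≤ a + suc b → InRegion a b
  inRegion-dec-b {a} {b} ω a<b+m bottom =
    region (≤-pred a<b+m) (≤-trans (n≤1+n b) (b≤a+m ω)) (subst (m ≤_) (+-suc a b) bottom)
           (≤-trans (s≤s (+-monoʳ-≤ a (n≤1+n b))) (1+a+b≤2n+m ω))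

  move-inc-a : ∀ {a b a′ b′ k} → InRegion a b → a < a′ → suc a ≤ b + m → suc (suc (a + b)) ≤ 2 * n + m →
               manhattan a b a′ b′ ≡ suc k → StepToward a b a′ b′ k
  move-inc-a {b = b} {b′ = b′} ω a<a′ right top e =
    _ , _ , inRegion-inc-a ω right top , inc-a , closer-inc-a {b = b} {b′ = b′} a<a′ e

  move-dec-a : ∀ {a b a′ b′ k} → InRegion a b → a′ < a → suc b ≤ a + m → m ≤ a + b →
               manhattan a b a′ b′ ≡ suc k → StepToward a b a′ b′ k
  move-dec-a {suc a} {b} {b′ = b′} ω (s≤s a′≤a) left bottom e =
    _ , _ , inRegion-dec-a ω left bottom , dec-a , closer-dec-a {b = b} {b′ = b′} a′≤a e

  move-inc-b : ∀ {a b a′ b′ k} → InRegion a b → b < b′ → suc b ≤ a + m → suc (suc (a + b)) ≤ 2 * n + m →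
               manhattan a b a′ b′ ≡ suc k → StepToward a b a′ b′ k
  move-inc-b {a} {a′ = a′} ω b<b′ left top e =
    _ , _ , inRegion-inc-b ω left top , inc-b , closer-inc-b {a} {a′ = a′} b<b′ e

  move-dec-b : ∀ {a b a′ b′ k} → InRegion a b → b′ < b → suc a ≤ b + m → m ≤ a + b →
               manhattan a b a′ b′ ≡ suc k → StepToward a b a′ b′ k
  move-dec-b {a} {suc b} {a′} ω (s≤s b′≤b) right bottom e =
    _ , _ , inRegion-dec-b ω right bottom , dec-b , closer-dec-b {a} {a′ = a′} b′≤b e

  step-right : ∀ {a b a′ b′ k} → InRegion a b → InRegion a′ b′ → a < a′ → manhattan a b a′ b′ ≡ suc k →
               StepToward a b a′ b′ k
  step-right {a} {b} {a′} {b′} ω ω′ a<a′ e with suc a ≤? b + m | suc (suc (a + b)) ≤? 2 * n + m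
  ... | yes right | yes top = move-inc-a ω a<a′ right top e
  ... | no ¬right | _       = move-inc-b ω b<b′ left top e
    where
      b+m≤a : b + m ≤ a
      b+m≤a = ≤-pred (≰⇒> ¬right)
      b<b′ : b < b′
      b<b′ = +-cancelʳ-< m b b′ (≤-trans (s≤s b+m≤a) (≤-trans a<a′ (a≤b+m ω′)))
      left : suc b ≤ a + m
      left = ≤-trans (1+x≤x+m b) (≤-trans b+m≤a (m≤m+n a m))
      top : suc (suc (a + b)) ≤ 2 * n + m
      top = ≤-trans (s≤s (+-mono-< a<a′ b<b′)) (1+a+b≤2n+m ω′)
  ... | yes right | no ¬top = move-dec-b ω b′<b right bottom e
    where
      2n+m≤1+a+b : 2 * n + m ≤ suc (a + b)
      2n+m≤1+a+b = ≤-pred (≰⇒> ¬top)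
      b′<b : b′ < b
      b′<b = +-cancelˡ-< a b′ b (≤-trans (+-monoˡ-≤ b′ a<a′) (≤-pred (≤-trans (1+a+b≤2n+m ω′) 2n+m≤1+a+b)))
      bottom : m ≤ a + b
      bottom = <⇒≤ (≤-pred (≤-trans 2+m≤2n+m 2n+m≤1+a+b))

  step-left : ∀ {a b a′ b′ k} → InRegion a b → InRegion a′ b′ → a′ < a → manhattan a b a′ b′ ≡ suc k →
              StepToward a b a′ b′ k
  step-left {a} {b} {a′} {b′} ω ω′ a′<a e with suc b ≤? a + m | m ≤? a + b
  ... | yes left | yes bottom = move-dec-a ω a′<a left bottom e
  ... | no ¬left | _          = move-dec-b ω b′<b right bottom e
    where
      a+m≤b : a + m ≤ b
      a+m≤b = ≤-pred (≰⇒> ¬left)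
      b′<b : b′ < b
      b′<b = ≤-trans (s≤s (b≤a+m ω′)) (≤-trans (+-monoˡ-≤ m a′<a) a+m≤b)
      right : suc a ≤ b + m
      right = ≤-trans (1+x≤x+m a) (≤-trans a+m≤b (m≤m+n b m))
      bottom : m ≤ a + b
      bottom = ≤-trans (m≤n+m m a) (≤-trans a+m≤b (m≤n+m b a))
  ... | yes left | no ¬bottom = move-inc-b ω b<b′ left top e
    where
      1+a+b≤m : suc (a + b) ≤ m
      1+a+b≤m = ≰⇒> ¬bottom
      b<b′ : b < b′
      b<b′ = +-cancelˡ-< a b b′ (≤-<-trans (≤-pred (≤-trans 1+a+b≤m (m≤1+a+b ω′))) (+-monoˡ-< b′ a′<a))
      top : suc (suc (a + b)) ≤ 2 * n + m
      top = ≤-trans (s≤s 1+a+b≤m) (≤-trans (n≤1+n _) 2+m≤2n+m)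

  step-vertical : ∀ {a b b′ k} → InRegion a b → InRegion a b′ → manhattan a b a b′ ≡ suc k →
                  StepToward a b a b′ k
  step-vertical {a} {b} {b′} ω ω′ e with <-cmp b b′
  ... | tri< b<b′ _ _ =
    move-inc-b ω b<b′ (≤-trans b<b′ (b≤a+m ω′)) (≤-trans (s≤s (+-monoʳ-< a b<b′)) (1+a+b≤2n+m ω′)) e
  ... | tri> _ _ b′<b =
    move-dec-b ω b′<b (≤-trans (s≤s (a≤b+m ω′)) (+-monoˡ-≤ m b′<b))
                      (≤-trans (m≤1+a+b ω′) (+-monoʳ-< a b′<b)) e
  ... | tri≈ _ refl _ with trans (sym e) (cong₂ _+_ (∣n-n∣≡0 a) (∣n-n∣≡0 b))
  ...   | ()

  -- Step a towards a′ if no wall is in the way; a wall blocking that step also forces b′ to lie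
  -- on the side of b where the b-step is free.
  step-toward : ∀ {a b a′ b′ k} → InRegion a b → InRegion a′ b′ → manhattan a b a′ b′ ≡ suc k →
                StepToward a b a′ b′ k
  step-toward {a} {a′ = a′} ω ω′ e with <-cmp a a′
  ... | tri< a<a′ _ _ = step-right ω ω′ a<a′ e
  ... | tri> _ _ a′<a = step-left ω ω′ a′<a e
  ... | tri≈ _ refl _ = step-vertical ω ω′ e

  d : V → V → ℕ
  d u v = manhattan (P u) (Q u) (P v) (Q v)

  d-changesByOne : ChangesByOne Adj d
  d-changesByOne u w u~w r = gridAdj⇒OneApart (adj⇒gridAdj {u} {w} u~w) (P r) (Q r)

  walk : ∀ k {u v} → d u v ≡ k → Walk Adj u v k
  walk zero {u} {v} e =
    subst (λ x → Walk Adj u x 0)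
          (PQ-injective {u} {v} (∣m-n∣≡0⇒m≡n (m+n≡0⇒m≡0 _ e)) (∣m-n∣≡0⇒m≡n (m+n≡0⇒n≡0 _ e))) nil
  walk (suc k) {u} {v} e with step-toward (inRegion u) (inRegion v) e
  ... | _ , _ , ω₁ , u→w , e₁ with vertex-in ω₁
  ...   | vertexAt w refl refl = cons (gridAdj⇒adj {u} {w} u→w) (walk k {w} {v} e₁)

  d-isDist : ∀ u v → IsDist Adj u v (d u v)
  d-isDist u v = walk _ refl , λ _ → d≤walk-length Adj d d-refl d-changesByOne
    where
      d-refl : ∀ v → d v v ≡ 0
      d-refl v = cong₂ _+_ (∣n-n∣≡0 (P v)) (∣n-n∣≡0 (Q v))

module LowerBound (m n : ℕ) (1≤m : 1 ≤ m) (2≤n : 2 ≤ n) where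

  open Coordinates m n
  open Distance m n 1≤m (≤-trans (s≤s z≤n) 2≤n)
  open MetricDimension Adj d d-isDist
  open import Data.List.Relation.Unary.All using ([]; _∷_)
  open import Data.List.Relation.Unary.AllPairs using ([]; _∷_)

  record Interior (a b : ℕ) : Set where
    constructor interior
    field
      1+a≤b+m    : suc a ≤ b + m
      1+b≤a+m    : suc b ≤ a + m
      m≤a+b      : m ≤ a + b
      2+a+b≤2n+m : suc (suc (a + b)) ≤ 2 * n + m
  open Interior

  interior⇒inRegion : ∀ {a b} → Interior a b → InRegion a b
  interior⇒inRegion I = region (≤-trans (n≤1+n _) (1+a≤b+m I)) (≤-trans (n≤1+n _) (1+b≤a+m I))
                               (≤-trans (m≤a+b I) (n≤1+n _)) (≤-trans (n≤1+n _) (2+a+b≤2n+m I))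

  record NeighbourAt (w : V) (a b : ℕ) : Set where
    constructor neighbourAt
    field
      at       : VertexAt a b
      adjacent : Adj w (vertex at)
  open NeighbourAt

  neighbour : ∀ w {a b a′ b′} → P w ≡ a → Q w ≡ b → InRegion a′ b′ → GridAdj a b a′ b′ → NeighbourAt w a′ b′
  neighbour w refl refl ω′ g with vertex-in ω′
  ... | at@(vertexAt x refl refl) = neighbourAt at (gridAdj⇒adj {w} {x} g)

  interior⇒positive : ∀ {a b} → Interior a b → ∃₂ λ a₀ b₀ → a ≡ suc a₀ × b ≡ suc b₀
  interior⇒positive {zero}  {b}    I = ⊥-elim (1+n≰n (≤-trans (1+b≤a+m I) (m≤a+b I)))
  interior⇒positive {suc a} {zero} I =
    ⊥-elim (1+n≰n (≤-trans (1+a≤b+m I) (≤-trans (m≤a+b I) (≤-reflexive (+-identityʳ _)))))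
  interior⇒positive {suc a} {suc b} _ = a , b , refl , refl

  twins-near-interior : ∀ w {r₁} r₂ {a b} → P w ≡ suc a → Q w ≡ suc b → Interior (suc a) (suc b) →
                        d w r₁ ≤ 1 → Twins r₁ r₂
  twins-near-interior w r₂ {a} {b} p q I dw≤1 =
    twins-near-four-neighbours d-changesByOne _≟ᵥ_ w r₂ dw≤1
      (adjacent N₁ ∷ adjacent N₂ ∷ adjacent N₃ ∷ adjacent N₄ ∷ [])
      ((apart N₁ N₂ (inj₁ (>⇒≢ (m<n⇒m<1+n (n<1+n a)))) ∷ apart N₁ N₃ (inj₁ (>⇒≢ (n<1+n _))) ∷
        apart N₁ N₄ (inj₁ (>⇒≢ (n<1+n _))) ∷ []) ∷
       (apart N₂ N₃ (inj₁ (<⇒≢ (n<1+n a))) ∷ apart N₂ N₄ (inj₁ (<⇒≢ (n<1+n a))) ∷ []) ∷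
       (apart N₃ N₄ (inj₂ (>⇒≢ (m<n⇒m<1+n (n<1+n b)))) ∷ []) ∷ [] ∷ [])
    where
      ω : InRegion (suc a) (suc b)
      ω = interior⇒inRegion I
      N₁ : NeighbourAt w (suc (suc a)) (suc b)
      N₁ = neighbour w p q (inRegion-inc-a ω (1+a≤b+m I) (2+a+b≤2n+m I)) inc-a
      N₂ : NeighbourAt w a (suc b)
      N₂ = neighbour w p q (inRegion-dec-a ω (1+b≤a+m I) (m≤a+b I)) dec-a
      N₃ : NeighbourAt w (suc a) (suc (suc b))
      N₃ = neighbour w p q (inRegion-inc-b ω (1+b≤a+m I) (2+a+b≤2n+m I)) inc-b
      N₄ : NeighbourAt w (suc a) b
      N₄ = neighbour w p q (inRegion-dec-b ω (1+a≤b+m I) (m≤a+b I)) dec-b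
      apart : ∀ {a₁ b₁ a₂ b₂} (x : NeighbourAt w a₁ b₁) (y : NeighbourAt w a₂ b₂) → a₁ ≢ a₂ ⊎ b₁ ≢ b₂ →
              vertex (at x) ≢ vertex (at y)
      apart x y = distinct-positions (at x) (at y)

  Inward : ℕ → ℕ → Set
  Inward a b = ∃₂ λ a′ b′ → GridAdj a b a′ b′ × Interior a′ b′

  inward-dec-a : ∀ {a b} → InRegion a b → suc m ≤ a + b → suc (suc b) ≤ a + m → Inward a b
  inward-dec-a {zero} {b} _ m<b b+2≤m = ⊥-elim (1+n≰n (≤-trans (≤-trans (n≤1+n _) b+2≤m) (<⇒≤ m<b)))
  inward-dec-a {suc a} ω m<a+b b+2≤a+m =
    _ , _ , dec-a , interior (a≤b+m ω) (≤-pred b+2≤a+m) (≤-pred m<a+b) (1+a+b≤2n+m ω)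

  inward-dec-b : ∀ {a b} → InRegion a b → suc m ≤ a + b → suc (suc a) ≤ b + m → Inward a b
  inward-dec-b {a} {zero} _ m<a a+2≤m =
    ⊥-elim (1+n≰n (≤-trans (≤-trans (n≤1+n _) a+2≤m) (<⇒≤ (subst (suc m ≤_) (+-identityʳ a) m<a))))
  inward-dec-b {a} {suc b} ω m<a+b a+2≤b+m =
    _ , _ , dec-b ,
    interior (≤-pred a+2≤b+m) (b≤a+m ω) (≤-pred (subst (suc m ≤_) (+-suc a b) m<a+b))
             (subst (_≤ 2 * n + m) (cong suc (+-suc a b)) (1+a+b≤2n+m ω))

  ¬3+s≤2n+m⇒1+m≤s : ∀ {s} → ¬ (3 + s ≤ 2 * n + m) → suc m ≤ s
  ¬3+s≤2n+m⇒1+m≤s ¬up = <⇒≤ (≤-pred (≤-pred (≤-trans 4+m≤2n+m (≤-pred (≰⇒> ¬up)))))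
    where
      4+m≤2n+m : 4 + m ≤ 2 * n + m
      4+m≤2n+m = +-monoˡ-≤ m (*-monoʳ-≤ 2 2≤n)

  ¬2+a≤b+m∧¬2+b≤a+m⇒m≡1∧a≡b : ∀ {a b} → ¬ (2 + a ≤ b + m) → ¬ (2 + b ≤ a + m) → m ≡ 1 × a ≡ b
  ¬2+a≤b+m∧¬2+b≤a+m⇒m≡1∧a≡b {a} {b} a+2≰b+m b+2≰a+m = m≡1 , a≡b
    where
      b+m≤1+a : b + m ≤ suc a
      b+m≤1+a = ≤-pred (≰⇒> a+2≰b+m)
      a+m≤1+b : a + m ≤ suc b
      a+m≤1+b = ≤-pred (≰⇒> b+2≰a+m)
      a≡b : a ≡ b
      a≡b = ≤-antisym (+-cancelʳ-≤ 1 a b (≤-trans (+-monoʳ-≤ a 1≤m) (subst (a + m ≤_) (+-comm 1 b) a+m≤1+b)))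
                      (+-cancelʳ-≤ 1 b a (≤-trans (+-monoʳ-≤ b 1≤m) (subst (b + m ≤_) (+-comm 1 a) b+m≤1+a)))
      m≡1 : m ≡ 1
      m≡1 = ≤-antisym (+-cancelˡ-≤ a m 1 (subst (a + m ≤_) (trans (cong suc (sym a≡b)) (+-comm 1 a)) a+m≤1+b))
                      1≤m

  -- Step a + b away from the top or bottom wall and a - b away from the side walls.
  near-interior : ∀ {a b} → InRegion a b → Inward a b ⊎ (m ≡ 1 × a ≡ b)
  near-interior {a} {b} ω with 2 + a ≤? b + m | 2 + b ≤? a + m | 3 + (a + b) ≤? 2 * n + m
  ... | no a+2≰b+m  | no b+2≰a+m  | _ = inj₂ (¬2+a≤b+m∧¬2+b≤a+m⇒m≡1∧a≡b a+2≰b+m b+2≰a+m)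
  ... | yes a+2≤b+m | _           | yes up =
    inj₁ (_ , _ , inc-a , interior a+2≤b+m (s≤s (b≤a+m ω)) (m≤1+a+b ω) up)
  ... | no _        | yes b+2≤a+m | yes up =
    inj₁ (_ , _ , inc-b , interior (s≤s (a≤b+m ω)) b+2≤a+m (subst (m ≤_) (sym (+-suc a b)) (m≤1+a+b ω))
                                   (subst (_≤ 2 * n + m) (cong (suc ∘ suc) (sym (+-suc a b))) up))
  ... | yes a+2≤b+m | _           | no ¬up = inj₁ (inward-dec-b ω (¬3+s≤2n+m⇒1+m≤s ¬up) a+2≤b+m)
  ... | no _        | yes b+2≤a+m | no ¬up = inj₁ (inward-dec-a ω (¬3+s≤2n+m⇒1+m≤s ¬up) b+2≤a+m)

  twins-beside : ∀ r₁ r₂ {a′ b′} → GridAdj (P r₁) (Q r₁) a′ b′ → Interior a′ b′ → Twins r₁ r₂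
  twins-beside r₁ r₂ g I with neighbour r₁ refl refl (interior⇒inRegion I) g | interior⇒positive I
  ... | neighbourAt (vertexAt w p q) r₁~w | _ , _ , refl , refl =
    twins-near-interior w r₂ p q I (≤-reflexive (adj⇒d≡1 d-changesByOne _≟ᵥ_ {r₁} {w} r₁~w))

  -- (1, 0) and (0, 1) are exchanged by the symmetry a ↔ b, which fixes the diagonal pointwise.
  twins-of-mirror-pair : VertexAt 1 0 → VertexAt 0 1 → ∀ {r₁ r₂} → P r₁ ≡ Q r₁ → P r₂ ≡ Q r₂ → Twins r₁ r₂
  twins-of-mirror-pair S@(vertexAt s Ps≡1 Qs≡0) T@(vertexAt t Pt≡0 Qt≡1) {r₁} {r₂} diag₁ diag₂ =
    twins {s = s} {t} (distinct-positions S T (inj₁ (λ ()))) (equidistant {r₁} diag₁) (equidistant {r₂} diag₂)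
    where
      equidistant : ∀ {r} → P r ≡ Q r → d s r ≡ d t r
      equidistant {r} diag = begin
        ∣ P s - P r ∣ + ∣ Q s - Q r ∣  ≡⟨ cong₂ (λ x y → ∣ x - P r ∣ + ∣ y - Q r ∣) Ps≡1 Qs≡0 ⟩
        ∣ 1 - P r ∣ + Q r              ≡⟨ cong (λ y → ∣ 1 - P r ∣ + y) (sym diag) ⟩
        ∣ 1 - P r ∣ + P r              ≡⟨ +-comm ∣ 1 - P r ∣ (P r) ⟩
        P r + ∣ 1 - P r ∣              ≡⟨ cong (λ y → P r + ∣ 1 - y ∣) diag ⟩
        P r + ∣ 1 - Q r ∣              ≡⟨ sym (cong₂ (λ x y → ∣ x - P r ∣ + ∣ y - Q r ∣) Pt≡0 Qt≡1) ⟩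
        ∣ P t - P r ∣ + ∣ Q t - Q r ∣  ∎
        where open ≡-Reasoning

  twins-on-diagonal : m ≡ 1 → ∀ {r₁ r₂} → P r₁ ≡ Q r₁ → P r₂ ≡ Q r₂ → Twins r₁ r₂
  twins-on-diagonal m≡1 =
    twins-of-mirror-pair (vertex-in (region 1≤m z≤n m≤2 2≤2n+m)) (vertex-in (region z≤n 1≤m m≤2 2≤2n+m))
    where
      m≤2 : m ≤ 2
      m≤2 = ≤-trans (≤-reflexive m≡1) (n≤1+n 1)
      2≤2n+m : 2 ≤ 2 * n + m
      2≤2n+m = ≤-trans (*-monoʳ-≤ 2 (≤-trans (n≤1+n 1) 2≤n)) (m≤m+n _ m)

  every-pair-has-twins : ∀ r₁ r₂ → Twins r₁ r₂
  every-pair-has-twins r₁ r₂ with near-interior (inRegion r₁) | near-interior (inRegion r₂)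
  ... | inj₁ (_ , _ , g , I) | _ = twins-beside r₁ r₂ g I
  ... | inj₂ _ | inj₁ (_ , _ , g , I) = Twins-sym (twins-beside r₂ r₁ g I)
  every-pair-has-twins r₁ r₂ | inj₂ (m≡1 , diag₁) | inj₂ (_ , diag₂) = twins-on-diagonal m≡1 diag₁ diag₂

  lower-bound : ∀ R → Resolving Adj R → 3 ≤ length R
  lower-bound = 3≤length-resolving (vertex (vertex-in corner)) every-pair-has-twins
    where
      corner : InRegion 0 m
      corner = region z≤n ≤-refl (n≤1+n m) (+-monoˡ-≤ m (≤-trans (s≤s z≤n) (*-monoʳ-≤ 2 2≤n)))

m≤n⇒∣m-n∣+m≡n : ∀ {m n} → m ≤ n → ∣ m - n ∣ + m ≡ n
m≤n⇒∣m-n∣+m≡n m≤n = trans (cong (_+ _) (m≤n⇒∣m-n∣≡n∸m m≤n)) (m∸n+n≡m m≤n)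

n≤m⇒∣m-n∣+n≡m : ∀ {m n} → n ≤ m → ∣ m - n ∣ + n ≡ m
n≤m⇒∣m-n∣+n≡m n≤m = trans (cong (_+ _) (m≤n⇒∣n-m∣≡n∸m n≤m)) (m∸n+n≡m n≤m)

x+∣y-k∣≡x′+∣y′-k∣⇒x+y′≡x′+y : ∀ x x′ {y y′ k} → y ≤ k → y′ ≤ k →
                               x + ∣ y - k ∣ ≡ x′ + ∣ y′ - k ∣ → x + y′ ≡ x′ + y
x+∣y-k∣≡x′+∣y′-k∣⇒x+y′≡x′+y x x′ {y} {y′} {k} y≤k y′≤k =
  cancel (m≤n⇒∣m-n∣+m≡n y≤k) (m≤n⇒∣m-n∣+m≡n y′≤k)
  where
    cancel : ∀ {p p′} → p + y ≡ k → p′ + y′ ≡ k → x + p ≡ x′ + p′ → x + y′ ≡ x′ + y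
    cancel {p} {p′} p+y≡k p′+y′≡k eq = +-cancelʳ-≡ k _ _ (begin
      x + y′ + k               ≡⟨ cong (x + y′ +_) (sym p+y≡k) ⟩
      x + y′ + (p + y)         ≡⟨ solve (x ∷ y′ ∷ p ∷ y ∷ []) ⟩
      (x + p) + (y + y′)       ≡⟨ cong (_+ (y + y′)) eq ⟩
      (x′ + p′) + (y + y′)     ≡⟨ solve (x′ ∷ p′ ∷ y ∷ y′ ∷ []) ⟩
      x′ + y + (p′ + y′)       ≡⟨ cong (x′ + y +_) p′+y′≡k ⟩
      x′ + y + k               ∎)
      where open ≡-Reasoning

x+y≡x′+y′∧x+z′≡x′+z⇒y+z≡y′+z′ : ∀ x x′ {y y′ z z′} → x + y ≡ x′ + y′ → x + z′ ≡ x′ + z → y + z ≡ y′ + z′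
x+y≡x′+y′∧x+z′≡x′+z⇒y+z≡y′+z′ x x′ {y} {y′} {z} {z′} e e′ = +-cancelˡ-≡ (x + x′) _ _ (begin
  x + x′ + (y + z)        ≡⟨ solve (x ∷ x′ ∷ y ∷ z ∷ []) ⟩
  (x + y) + (x′ + z)      ≡⟨ cong₂ _+_ e (sym e′) ⟩
  (x′ + y′) + (x + z′)    ≡⟨ solve (x ∷ x′ ∷ y′ ∷ z′ ∷ []) ⟩
  x + x′ + (y′ + z′)      ∎)
  where open ≡-Reasoning

∣m-o∣+m≡∣n-o∣+n⇒m≡n⊎m,n≤o : ∀ {m n o} → ∣ m - o ∣ + m ≡ ∣ n - o ∣ + n → m ≡ n ⊎ (m ≤ o × n ≤ o)
∣m-o∣+m≡∣n-o∣+n⇒m≡n⊎m,n≤o {m} {n} {o} eq with ≤-total o m | ≤-total o n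
... | inj₁ o≤m | inj₁ o≤n = inj₁ (*-cancelˡ-≡ m n 2 (begin
  2 * m                   ≡⟨ sym (twice o≤m) ⟩
  ∣ m - o ∣ + m + o       ≡⟨ cong (_+ o) eq ⟩
  ∣ n - o ∣ + n + o       ≡⟨ twice o≤n ⟩
  2 * n                   ∎))
  where
    open ≡-Reasoning
    twice′ : ∀ {p x} → p + o ≡ x → p + x + o ≡ 2 * x
    twice′ {p} {x} p+o≡x = begin
      p + x + o       ≡⟨ solve (p ∷ x ∷ o ∷ []) ⟩
      (p + o) + x     ≡⟨ cong (_+ x) p+o≡x ⟩
      x + x           ≡⟨ solve (x ∷ []) ⟩
      2 * x           ∎
    twice : ∀ {x} → o ≤ x → ∣ x - o ∣ + x + o ≡ 2 * x
    twice o≤x = twice′ (n≤m⇒∣m-n∣+n≡m o≤x)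
... | _        | inj₂ n≤o = inj₂ (subst (m ≤_) (trans eq (m≤n⇒∣m-n∣+m≡n n≤o)) (m≤n+m m ∣ m - o ∣) , n≤o)
... | inj₂ m≤o | _        = inj₂ (m≤o , subst (n ≤_) (trans (sym eq) (m≤n⇒∣m-n∣+m≡n m≤o)) (m≤n+m n ∣ n - o ∣))

resolved-in-box : ∀ {M h a b a′ b′} → a ≤ h → a′ ≤ h → b ≤ M → b′ ≤ M →
                  a + ∣ b - M ∣ ≡ a′ + ∣ b′ - M ∣ → ∣ a - h ∣ + b′ ≡ ∣ a′ - h ∣ + b → b ≡ b′
resolved-in-box {M} {h} {a} {b} {a′} {b′} a≤h a′≤h b≤M b′≤M e₁ e₃ =
  sym (*-cancelˡ-≡ b′ b 2 (+-cancelʳ-≡ (a + a′) _ _ (begin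
    2 * b′ + (a + a′)      ≡⟨ solve (a ∷ b′ ∷ a′ ∷ []) ⟩
    (a + b′) + (b′ + a′)   ≡⟨ cong₂ _+_ (x+∣y-k∣≡x′+∣y′-k∣⇒x+y′≡x′+y a a′ b≤M b′≤M e₁)
                                        (x+∣y-k∣≡x′+∣y′-k∣⇒x+y′≡x′+y b′ b a≤h a′≤h e₃′) ⟩
    (a′ + b) + (b + a)     ≡⟨ solve (a′ ∷ b ∷ a ∷ []) ⟩
    2 * b + (a + a′)       ∎)))
  where
    open ≡-Reasoning
    e₃′ : b′ + ∣ a - h ∣ ≡ b + ∣ a′ - h ∣
    e₃′ = trans (+-comm b′ _) (trans e₃ (+-comm _ b))

resolved-by-three : ∀ {M h c a b a′ b′} → c ≤ M → c + M ≡ h ⊎ c ≡ 0 →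
  a ≤ b + M → a′ ≤ b′ + M → b ≤ h + M → b′ ≤ h + M →
  manhattan a b 0 M ≡ manhattan a′ b′ 0 M →
  manhattan a b h c ≡ manhattan a′ b′ h c →
  manhattan a b h (h + M) ≡ manhattan a′ b′ h (h + M) →
  a ≡ a′ × b ≡ b′
resolved-by-three {M} {h} {c} {a} {b} {a′} {b′} c≤M c+M≡h⊎c≡0 a≤b+M a′≤b′+M b≤h+M b′≤h+M e₁ e₂ e₃ =
  +-cancelʳ-≡ _ a a′ (trans e₁′ (cong (λ z → a′ + ∣ z - M ∣) (sym b≡b′))) , b≡b′
  where
    open ≡-Reasoning
    e₁′ : a + ∣ b - M ∣ ≡ a′ + ∣ b′ - M ∣
    e₁′ = trans (cong (_+ ∣ b - M ∣) (sym (∣-∣-identityʳ a)))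
                (trans e₁ (cong (_+ ∣ b′ - M ∣) (∣-∣-identityʳ a′)))
    e₃′ : ∣ a - h ∣ + b′ ≡ ∣ a′ - h ∣ + b
    e₃′ = x+∣y-k∣≡x′+∣y′-k∣⇒x+y′≡x′+y ∣ a - h ∣ ∣ a′ - h ∣ b≤h+M b′≤h+M e₃
    φ-eq : ∣ b - c ∣ + b ≡ ∣ b′ - c ∣ + b′
    φ-eq = x+y≡x′+y′∧x+z′≡x′+z⇒y+z≡y′+z′ ∣ a - h ∣ ∣ a′ - h ∣ e₂ e₃′
    below-h : ∀ {x y} → c + M ≡ h → x ≤ y + M → y ≤ c → x ≤ h
    below-h c+M≡h x≤y+M y≤c = ≤-trans x≤y+M (subst (_ ≤_) c+M≡h (+-monoˡ-≤ M y≤c))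
    both-below : c + M ≡ h ⊎ c ≡ 0 → b ≤ c → b′ ≤ c → b ≡ b′
    both-below (inj₁ c+M≡h) b≤c b′≤c =
      resolved-in-box (below-h c+M≡h a≤b+M b≤c) (below-h c+M≡h a′≤b′+M b′≤c)
                      (≤-trans b≤c c≤M) (≤-trans b′≤c c≤M) e₁′ e₃′
    both-below (inj₂ c≡0) b≤c b′≤c =
      trans (n≤0⇒n≡0 (subst (b ≤_) c≡0 b≤c)) (sym (n≤0⇒n≡0 (subst (b′ ≤_) c≡0 b′≤c)))
    b≡b′ : b ≡ b′
    b≡b′ with ∣m-o∣+m≡∣n-o∣+n⇒m≡n⊎m,n≤o φ-eq
    ... | inj₁ b≡b′         = b≡b′
    ... | inj₂ (b≤c , b′≤c) = both-below c+M≡h⊎c≡0 b≤c b′≤c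

b≤a+m∧1+a+b≤2+2h+m⇒b≤h+m : ∀ {a b h m} → b ≤ a + m → suc (a + b) ≤ 2 * suc h + m → b ≤ h + m
b≤a+m∧1+a+b≤2+2h+m⇒b≤h+m {a} {b} {h} {m} b≤a+m top = ≤-pred (*-cancelˡ-< 2 b (suc (h + m)) (begin
  suc (2 * b)            ≡⟨ solve (b ∷ []) ⟩
  suc (b + b)            ≤⟨ s≤s (+-monoˡ-≤ b b≤a+m) ⟩
  suc (a + m + b)        ≡⟨ solve (a ∷ m ∷ b ∷ []) ⟩
  suc (a + b) + m        ≤⟨ +-monoˡ-≤ m top ⟩
  2 * suc h + m + m      ≡⟨ solve (h ∷ m ∷ []) ⟩
  2 * suc (h + m)        ∎))
  where open ≤-Reasoning

2+[h+h]≡2[1+h] : ∀ h → 2 + (h + h) ≡ 2 * suc h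
2+[h+h]≡2[1+h] = solve-∀

2+h+[h+m]≡2[1+h]+m : ∀ h m → 2 + (h + (h + m)) ≡ 2 * suc h + m
2+h+[h+m]≡2[1+h]+m = solve-∀

module UpperBound (m h : ℕ) (1≤m : 1 ≤ m) (1≤h : 1 ≤ h) (m≤1+h : m ≤ suc h) (h≤2m : h ≤ 2 * m) where

  open Coordinates m (suc h)
  open Distance m (suc h) 1≤m (s≤s z≤n)
  open MetricDimension Adj d d-isDist
  open import Data.List.Relation.Unary.All using ([]; _∷_)
  open import Data.List.Relation.Unary.AllPairs using ([]; _∷_)

  -- For m = n, i.e. h < m, the truncated subtraction gives c = 0.
  c : ℕ
  c = h ∸ m

  c≤m : c ≤ m
  c≤m = m≤n+o⇒m∸n≤o h m (subst (h ≤_) (cong (m +_) (+-identityʳ m)) h≤2m)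

  c+m≡h⊎c≡0 : c + m ≡ h ⊎ c ≡ 0
  c+m≡h⊎c≡0 with ≤-total m h
  ... | inj₁ m≤h = inj₁ (m∸n+n≡m m≤h)
  ... | inj₂ h≤m = inj₂ (m≤n⇒m∸n≡0 h≤m)

  Q≤h+m : ∀ v → Q v ≤ h + m
  Q≤h+m v = b≤a+m∧1+a+b≤2+2h+m⇒b≤h+m (b≤a+m (inRegion v)) (1+a+b≤2n+m (inRegion v))

  L₁ : VertexAt 0 m
  L₁ = vertex-in (region z≤n ≤-refl (n≤1+n m) (+-monoˡ-≤ m (s≤s z≤n)))

  L₂ : VertexAt h c
  L₂ = vertex-in (region (subst (h ≤_) (+-comm m c) (m≤n+m∸n h m)) (≤-trans (m∸n≤m h m) (m≤m+n h m))
                         (≤-trans m≤1+h (s≤s (m≤m+n h c)))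
                         (≤-trans (s≤s (+-monoʳ-≤ h (m∸n≤m h m)))
                                  (≤-trans (n≤1+n _) (≤-trans (≤-reflexive (2+[h+h]≡2[1+h] h)) (m≤m+n _ m)))))

  L₃ : VertexAt h (h + m)
  L₃ = vertex-in (region (≤-trans (m≤m+n h m) (m≤m+n _ m)) ≤-refl
                         (≤-trans (m≤n+m m h) (≤-trans (m≤n+m (h + m) h) (n≤1+n _)))
                         (≤-trans (n≤1+n _) (≤-reflexive (2+h+[h+m]≡2[1+h]+m h m))))

  landmarks : List V
  landmarks = vertex L₁ ∷ vertex L₂ ∷ vertex L₃ ∷ []

  landmarks-unique : Unique landmarks
  landmarks-unique =
    (distinct-positions L₁ L₂ (inj₁ (<⇒≢ 1≤h)) ∷ distinct-positions L₁ L₃ (inj₁ (<⇒≢ 1≤h)) ∷ []) ∷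
    (distinct-positions L₂ L₃ (inj₂ (<⇒≢ c<h+m)) ∷ []) ∷ [] ∷ []
    where
      c<h+m : c < h + m
      c<h+m = ≤-trans (s≤s (m∸n≤m h m)) (subst (_≤ h + m) (+-comm h 1) (+-monoʳ-≤ h 1≤m))

  landmarks-resolving : Resolving Adj landmarks
  landmarks-resolving s t code = PQ-injective {s} {t} (proj₁ same-position) (proj₂ same-position)
    where
      seen-from : ∀ {x y} (L : VertexAt x y) → d s (vertex L) ≡ d t (vertex L) →
                  manhattan (P s) (Q s) x y ≡ manhattan (P t) (Q t) x y
      seen-from (vertexAt _ refl refl) e = e
      same-position : P s ≡ P t × Q s ≡ Q t
      same-position with sameCode⇒≡d {landmarks} {s} {t} code
      ... | e₁ ∷ e₂ ∷ e₃ ∷ [] =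
        resolved-by-three c≤m c+m≡h⊎c≡0 (a≤b+m (inRegion s)) (a≤b+m (inRegion t)) (Q≤h+m s) (Q≤h+m t)
                          (seen-from L₁ e₁) (seen-from L₂ e₂) (seen-from L₃ e₃)

  upper-bound : ∃ λ (R : List V) → Unique R × length R ≡ 3 × Resolving Adj R
  upper-bound = landmarks , landmarks-unique , refl , landmarks-resolving

theorem2 : (m n : ℕ) → 1 ≤ m → m ≤ n → 2 ≤ n → n ≤ 2 * m + 1 →
    MetricDim (VGAdj m n) 3
theorem2 m (suc h) 1≤m m≤n 2≤n@(s≤s 1≤h) n≤2m+1 =
  UpperBound.upper-bound m h 1≤m 1≤h m≤n h≤2m ,
  λ R _ → LowerBound.lower-bound m (suc h) 1≤m 2≤n R
  where
    h≤2m : h ≤ 2 * m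
    h≤2m = ≤-pred (subst (suc h ≤_) (+-comm (2 * m) 1) n≤2m+1)
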